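{- Let $r$ be a positive integer, $n$ an integer, and let $u,v\in L_{n(r+1)}$. Then: (1) if $u$ and $v$ are adjacent in $G_H$, at least one of $u,v$ lies in $C'$; (2) if $r\le d(u,v)\le 2r+1$, at least one of $u,v$ lies in $C'$. Furthermore, for every integer $x$, at least one of the vertices $(x+2k,\,n(r+1))$, $k=0,1,\ldots,\lceil (r+1)/2\rceil$, lies in $C'$.
   Context: The hexagonal grid $G_H$ (brick-wall representation) has vertex set $\mathbb{Z}\times\mathbb{Z}$; every vertex $(x,y)$ is adjacent to $(x-1,y)$ and $(x+1,y)$, and additionally to $(x,y+1)$ if $x+y$ is even, and to $(x,y-1)$ if $x+y$ is odd; $d$ is graph distance in $G_H$. For an integer $k$, $L_k=\{(x,k):x\in\mathbb{Z}\}$. Let $M=3r$ if $r$ is even and $M=3r-1$ if $r$ is odd, and let $L_k'=\{(x,k)\in L_k: x \bmod M \notin\{1,3,5,\ldots\}\cap[1,r-1]\}$, i.e. $L_k'$ consists of the points of $L_k$ whose $x$-coordinate is not congruent modulo $M$ to an odd integer in $[1,r-1]$. Set $C'=\bigcup_{n\in\mathbb{Z}}L'_{n(r+1)}$. -}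

module Defs where

open import Data.Nat as ℕ using (ℕ; zero; suc)
open import Data.Integer as ℤ using (ℤ; +_; _+_; _-_; _*_)
open import Data.Integer.Divisibility using (_∣_)
open import Data.Product using (_×_; _,_; ∃-syntax)
open import Data.Sum using (_⊎_)
open import Relation.Nullary using (¬_)
open import Relation.Binary.PropositionalEquality using (_≡_)

-- vertices of the hexagonal (brick-wall) grid G_H
Pt : Set
Pt = ℤ × ℤ

Adj : Pt → Pt → Set
Adj (x , y) (x' , y') =
  (y' ≡ y × (x' ≡ x + + 1 ⊎ x' ≡ x - + 1))
  ⊎ (x' ≡ x × ((+ 2 ∣ (x + y) × y' ≡ y + + 1)
              ⊎ (¬ (+ 2 ∣ (x + y)) × y' ≡ y - + 1)))

data Walk : Pt → Pt → ℕ → Set where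
  here : ∀ {u} → Walk u u zero
  step : ∀ {u w v k} → Adj u w → Walk w v k → Walk u v (suc k)

Dist : Pt → Pt → ℕ → Set
Dist u v k = Walk u v k × (∀ m → m ℕ.< k → ¬ Walk u v m)

Mod : ℕ → ℕ
Mod r with r ℕ.% 2
... | zero = 3 ℕ.* r
... | suc _ = 3 ℕ.* r ℕ.∸ 1

Excluded : ℕ → ℤ → Set
Excluded r x = ∃[ t ] ((2 ℕ.* t ℕ.+ 1 ℕ.≤ r ℕ.∸ 1) × (+ Mod r ∣ (x - + (2 ℕ.* t ℕ.+ 1))))

InL' : ℕ → ℤ → Pt → Set
InL' r k (x , y) = y ≡ k × ¬ Excluded r x

InC' : ℕ → Pt → Set
InC' r p = ∃[ n ] InL' r (n * + (suc r)) p

module Submission where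

open import Defs
open import Data.Nat as ℕ using (ℕ; suc; ⌈_/2⌉)
open import Data.Integer as ℤ using (ℤ; +_; _+_; _*_)
open import Data.Product using (_×_; _,_; ∃-syntax)
open import Data.Sum using (_⊎_)

open import Data.Nat using (zero; _≤_; _<_; _∸_; _/_; _%_; z≤n; s≤s)
open import Data.Nat.Properties as ℕP using (module ≤-Reasoning)
open import Data.Nat.DivMod using (m≡m%n+[m/n]*n; m%n<n; m/n*n≤m)
import Data.Nat.Divisibility as ℕ∣
open import Data.Nat.Tactic.RingSolver using (solve-∀)
open import Data.Integer using (_-_; -_; _⊖_; ∣_∣)
open import Data.Integer.Properties as ℤP using ()
open import Data.Integer.Divisibility using (_∣_)
open import Data.Integer.Divisibility.Signed using (∣ᵤ⇒∣; ∣⇒∣ᵤ; ∣m∣n⇒∣m-n)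
import Data.Integer.Tactic.RingSolver as ℤRing
open import Data.Product using (proj₁)
open import Data.Sum as Sum using (inj₁; inj₂)
open import Data.Empty using (⊥)
open import Function using (_∘_)
open import Relation.Nullary using (¬_; Dec; yes; no; contradiction)
open import Relation.Nullary.Decidable using (map′; _×-dec_)
open import Relation.Binary.PropositionalEquality

-- Write M = Mod r.  An abscissa x is excluded when x ≡ 2t+1 (mod M) for an
-- odd 2t+1 ≤ r-1; such t satisfy t < h = ⌊r/2⌋, and in both parity cases
-- M = 2h + 2r.  The proof rests on one arithmetic fact: two numbers in
-- [1, M] congruent modulo M are equal (congruent-in-range).
--   * If x and x+D are both excluded, with residues j₁ and j₂, then D + j₁
--     and j₂ are congruent, and D + j₁ ≤ M whenever D ≤ 2r+1, so D + j₁ = j₂.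
--     This is impossible for D = 1 (parity) and for D ≥ r (size).
--   * If x is excluded with residue 2t+1, then x + 2(h-t) has residue 2h+1,
--     which is not of the excluded form.
-- On the geometric side, two points of one row at graph distance k are
-- exactly k apart horizontally (dist-row), and adjacent points of one row are
-- 1 apart (adj-row).  Since every point of L_{n(r+1)} whose abscissa is not
-- excluded lies in C', the three parts of claim9 follow.

multiple-below : ∀ {M n} → M ℕ∣.∣ n → n < M → n ≡ 0
multiple-below {n = zero}  _   _   = refl
multiple-below {n = suc _} M∣n n<M = contradiction M∣n (ℕ∣.>⇒∤ n<M)

congruent-in-range : ∀ {M c c'} x → 1 ≤ c → c ≤ M → 1 ≤ c' → c' ≤ M →
  + M ∣ (x - + c) → + M ∣ (x - + c') → c ≡ c'
congruent-in-range {M} {suc a} {suc b} x (s≤s z≤n) a<M (s≤s z≤n) b<M M∣x-c M∣x-c' =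
  cong suc (ℤP.+-injective (ℤP.i-j≡0⇒i≡j (+ a) (+ b) a-b≡0))
  where
  open ≡-Reasoning
  difference : (x - + suc b) - (x - + suc a) ≡ a ⊖ b
  difference = begin
    (x - + suc b) - (x - + suc a) ≡⟨ cancel x (+ suc a) (+ suc b) ⟩
    + suc a - + suc b             ≡⟨ ℤP.m-n≡m⊖n (suc a) (suc b) ⟩
    suc a ⊖ suc b                 ≡⟨ ℤP.[1+m]⊖[1+n]≡m⊖n a b ⟩
    a ⊖ b                         ∎
    where
    cancel : ∀ x c c' → (x - c') - (x - c) ≡ c - c'
    cancel = ℤRing.solve-∀
  M∣difference : + M ∣ ((x - + suc b) - (x - + suc a))
  M∣difference = ∣⇒∣ᵤ (∣m∣n⇒∣m-n (∣ᵤ⇒∣ {+ M} {x - + suc b} M∣x-c')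
                                  (∣ᵤ⇒∣ {+ M} {x - + suc a} M∣x-c))
  M∣a⊖b : M ℕ∣.∣ ∣ a ⊖ b ∣
  M∣a⊖b = subst (λ i → M ℕ∣.∣ ∣ i ∣) difference M∣difference
  a⊖b<M : ∣ a ⊖ b ∣ < M
  a⊖b<M = ℕP.≤-<-trans (ℤP.∣m⊝n∣≤m⊔n a b) (ℕP.⊔-lub a<M b<M)
  a-b≡0 : + a - + b ≡ + 0
  a-b≡0 = trans (ℤP.m-n≡m⊖n a b) (ℤP.∣i∣≡0⇒i≡0 (multiple-below M∣a⊖b a⊖b<M))

shift-congruence : ∀ {m} x c d → m ∣ (x - + c) → m ∣ ((x + + d) - + (d ℕ.+ c))
shift-congruence {m} x c d = subst (m ∣_) (sym shifted)
  where
  open ≡-Reasoning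
  cancel : ∀ x c d → (x + d) - (d + c) ≡ x - c
  cancel = ℤRing.solve-∀
  shifted : (x + + d) - + (d ℕ.+ c) ≡ x - + c
  shifted = begin
    (x + + d) - + (d ℕ.+ c)   ≡⟨ cong (λ i → (x + + d) - i) (ℤP.pos-+ d c) ⟩
    (x + + d) - (+ d + + c)   ≡⟨ cancel x (+ c) (+ d) ⟩
    x - + c                   ∎

odd-positive : ∀ t → 1 ≤ 2 ℕ.* t ℕ.+ 1
odd-positive t = ℕP.m≤n+m 1 (2 ℕ.* t)

Mod≡ : ∀ r → Mod r ≡ 2 ℕ.* (r / 2) ℕ.+ 2 ℕ.* r
Mod≡ r with r % 2 | m≡m%n+[m/n]*n r 2 | m%n<n r 2
... | 0           | r≡ | _             = even-case (r / 2) r r≡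
  where
  identity : ∀ h → 3 ℕ.* (0 ℕ.+ h ℕ.* 2) ≡ 2 ℕ.* h ℕ.+ 2 ℕ.* (0 ℕ.+ h ℕ.* 2)
  identity = solve-∀
  even-case : ∀ h r → r ≡ 0 ℕ.+ h ℕ.* 2 → 3 ℕ.* r ≡ 2 ℕ.* h ℕ.+ 2 ℕ.* r
  even-case h _ refl = identity h
... | 1           | r≡ | _             = odd-case (r / 2) r r≡
  where
  identity : ∀ h → 3 ℕ.* (1 ℕ.+ h ℕ.* 2) ≡ suc (2 ℕ.* h ℕ.+ 2 ℕ.* (1 ℕ.+ h ℕ.* 2))
  identity = solve-∀
  odd-case : ∀ h r → r ≡ 1 ℕ.+ h ℕ.* 2 → 3 ℕ.* r ∸ 1 ≡ 2 ℕ.* h ℕ.+ 2 ℕ.* r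
  odd-case h _ refl = cong (_∸ 1) (identity h)
... | suc (suc _) | _  | s≤s (s≤s ())

bad-index : ∀ r t → 2 ℕ.* t ℕ.+ 1 ≤ r ∸ 1 → t < r / 2
bad-index r t le = ℕP.*-cancelˡ-< 2 t (r / 2) (begin-strict
    2 ℕ.* t        <⟨ ℕP.≤-reflexive (ℕP.+-comm 1 (2 ℕ.* t)) ⟩
    2 ℕ.* t ℕ.+ 1  ≤⟨ le ⟩
    r ∸ 1          ≤⟨ ℕP.m≤n+o⇒m∸n≤o r 1 r≤1+2h ⟩
    r / 2 ℕ.* 2    ≡⟨ ℕP.*-comm (r / 2) 2 ⟩
    2 ℕ.* (r / 2)  ∎)
  where
  open ≤-Reasoning
  r≤1+2h : r ≤ 1 ℕ.+ r / 2 ℕ.* 2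
  r≤1+2h = subst (_≤ 1 ℕ.+ r / 2 ℕ.* 2) (sym (m≡m%n+[m/n]*n r 2))
             (ℕP.+-monoˡ-≤ (r / 2 ℕ.* 2) (ℕP.≤-pred (m%n<n r 2)))

bad-room : ∀ r t D → 2 ℕ.* t ℕ.+ 1 ≤ r ∸ 1 → D ≤ 2 ℕ.* r ℕ.+ 1 →
           D ℕ.+ (2 ℕ.* t ℕ.+ 1) ≤ Mod r
bad-room r t D le D≤ = begin
    D ℕ.+ (2 ℕ.* t ℕ.+ 1)                  ≤⟨ ℕP.+-monoˡ-≤ (2 ℕ.* t ℕ.+ 1) D≤ ⟩
    (2 ℕ.* r ℕ.+ 1) ℕ.+ (2 ℕ.* t ℕ.+ 1)    ≡⟨ regroup r t ⟩
    2 ℕ.* suc t ℕ.+ 2 ℕ.* r                ≤⟨ ℕP.+-monoˡ-≤ (2 ℕ.* r)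
                                                 (ℕP.*-monoʳ-≤ 2 (bad-index r t le)) ⟩
    2 ℕ.* (r / 2) ℕ.+ 2 ℕ.* r              ≡⟨ sym (Mod≡ r) ⟩
    Mod r                                  ∎
  where
  open ≤-Reasoning
  regroup : ∀ r t → (2 ℕ.* r ℕ.+ 1) ℕ.+ (2 ℕ.* t ℕ.+ 1) ≡ 2 ℕ.* suc t ℕ.+ 2 ℕ.* r
  regroup = solve-∀

half≤⌈r+1/2⌉ : ∀ r → r / 2 ≤ ⌈ r ℕ.+ 1 /2⌉
half≤⌈r+1/2⌉ r = begin
    h                    ≡⟨ ℕP.n≡⌊n+n/2⌋ h ⟩
    ℕ.⌊ h ℕ.+ h /2⌋      ≤⟨ ℕP.⌊n/2⌋-mono h+h≤r ⟩
    ℕ.⌊ r /2⌋            ≤⟨ ℕP.⌊n/2⌋≤⌈n/2⌉ r ⟩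
    ⌈ r /2⌉              ≤⟨ ℕP.⌈n/2⌉-mono (ℕP.m≤m+n r 1) ⟩
    ⌈ r ℕ.+ 1 /2⌉        ∎
  where
  open ≤-Reasoning
  h = r / 2
  double : ∀ h → h ℕ.* 2 ≡ h ℕ.+ h
  double = solve-∀
  h+h≤r : h ℕ.+ h ≤ r
  h+h≤r = subst (_≤ r) (double h) (m/n*n≤m r 2)

row-split : ∀ a b → b ≡ a + + ∣ b - a ∣ ⊎ a ≡ b + + ∣ b - a ∣
row-split a b with ℤP.+∣i∣≡i⊎+∣i∣≡-i (b - a)
... | inj₁ eq = inj₁ (trans (rightward a b) (cong (λ i → a + i) (sym eq)))
  where
  rightward : ∀ a b → b ≡ a + (b - a)
  rightward = ℤRing.solve-∀
... | inj₂ eq = inj₂ (trans (leftward a b) (cong (λ i → b + i) (sym eq)))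
  where
  leftward : ∀ a b → a ≡ b + - (b - a)
  leftward = ℤRing.solve-∀

displacement : ∀ a z → (a + z) - a ≡ z
displacement = ℤRing.solve-∀

walk-right : ∀ a y n → Walk (a , y) (a + + n , y) n
walk-right a y zero    = subst (λ z → Walk (a , y) (z , y) 0) (sym (ℤP.+-identityʳ a)) here
walk-right a y (suc n) = step (inj₁ (refl , inj₁ refl))
  (subst (λ z → Walk (a + + 1 , y) (z , y) n) (regroup a (+ n)) (walk-right (a + + 1) y n))
  where
  regroup : ∀ a k → (a + + 1) + k ≡ a + (+ 1 + k)
  regroup = ℤRing.solve-∀

walk-left : ∀ b y n → Walk (b + + n , y) (b , y) n
walk-left b y zero    = subst (λ z → Walk (z , y) (b , y) 0) (sym (ℤP.+-identityʳ b)) here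
walk-left b y (suc n) = step (inj₁ (refl , inj₂ (regroup b (+ n)))) (walk-left b y n)
  where
  regroup : ∀ b k → b + k ≡ (b + (+ 1 + k)) - + 1
  regroup = ℤRing.solve-∀

row-walk : ∀ a b y → Walk (a , y) (b , y) ∣ b - a ∣
row-walk a b y with row-split a b
... | inj₁ b≡ = subst (λ z → Walk (a , y) (z , y) ∣ b - a ∣) (sym b≡) (walk-right a y _)
... | inj₂ a≡ = subst (λ z → Walk (z , y) (b , y) ∣ b - a ∣) (sym a≡) (walk-left b y _)

adj-shift : ∀ {a y c y'} → Adj (a , y) (c , y') → ∣ c - a ∣ ≤ 1
adj-shift {a} (inj₁ (_ , inj₁ refl)) = ℕP.≤-reflexive (cong ∣_∣ (displacement a (+ 1)))
adj-shift {a} (inj₁ (_ , inj₂ refl)) = ℕP.≤-reflexive (cong ∣_∣ (displacement a (- + 1)))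
adj-shift {a} (inj₂ (refl , _))      = subst (_≤ 1) (sym (cong ∣_∣ (ℤP.+-inverseʳ a))) z≤n

walk-shift : ∀ {a y b y' k} → Walk (a , y) (b , y') k → ∣ b - a ∣ ≤ k
walk-shift {a} here = ℕP.≤-reflexive (cong ∣_∣ (ℤP.+-inverseʳ a))
walk-shift {a} {b = b} {k = suc k} (step {w = c , _} adj walk) = begin
    ∣ b - a ∣                   ≡⟨ cong ∣_∣ (split a b c) ⟩
    ∣ (c - a) + (b - c) ∣       ≤⟨ ℤP.∣i+j∣≤∣i∣+∣j∣ (c - a) (b - c) ⟩
    ∣ c - a ∣ ℕ.+ ∣ b - c ∣     ≤⟨ ℕP.+-mono-≤ (adj-shift adj) (walk-shift walk) ⟩
    suc k                       ∎
  where
  open ≤-Reasoning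
  split : ∀ a b c → b - a ≡ (c - a) + (b - c)
  split = ℤRing.solve-∀

dist-row : ∀ {a b y k} → Dist (a , y) (b , y) k → ∣ b - a ∣ ≡ k
dist-row {a} {b} {y} (walk , minimal) =
  ℕP.≤-antisym (walk-shift walk) (ℕP.≮⇒≥ (λ lt → minimal _ lt (row-walk a b y)))

adj-row : ∀ {a b y} → Adj (a , y) (b , y) → ∣ b - a ∣ ≡ 1
adj-row {a} (inj₁ (_ , inj₁ refl)) = cong ∣_∣ (displacement a (+ 1))
adj-row {a} (inj₁ (_ , inj₂ refl)) = cong ∣_∣ (displacement a (- + 1))
adj-row {y = y} (inj₂ (_ , inj₁ (_ , y≡y+1))) =
  contradiction (trans y≡y+1 (ℤP.+-comm y (+ 1))) ℤP.i≢suc[i]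
adj-row {y = y} (inj₂ (_ , inj₂ (_ , y≡y-1))) =
  contradiction (trans (sym y≡y-1) (recentre y)) ℤP.i≢suc[i]
  where
  recentre : ∀ y → y ≡ + 1 + (y - + 1)
  recentre = ℤRing.solve-∀

module Exclusion (r : ℕ) where

  -- Being excluded is decidable: a witness t satisfies t < r.
  excluded? : ∀ x → Dec (Excluded r x)
  excluded? x = map′ (λ (t , _ , w) → t , w) (λ (t , w) → t , index<r t (proj₁ w) , w)
                     (ℕP.anyUpTo? witness? r)
    where
    Witness : ℕ → Set
    Witness t = 2 ℕ.* t ℕ.+ 1 ≤ r ∸ 1 × + Mod r ∣ (x - + (2 ℕ.* t ℕ.+ 1))
    witness? : ∀ t → Dec (Witness t)
    witness? t = (2 ℕ.* t ℕ.+ 1 ℕ.≤? r ∸ 1) ×-dec (Mod r ℕ∣.∣? ∣ x - + (2 ℕ.* t ℕ.+ 1) ∣)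
    index<r : ∀ t → 2 ℕ.* t ℕ.+ 1 ≤ r ∸ 1 → t < r
    index<r t le = ℕP.≤-trans (ℕP.m≤m+n (suc t) (t ℕ.+ 0))
      (ℕP.≤-trans (ℕP.≤-reflexive (ℕP.+-comm 1 (2 ℕ.* t))) (ℕP.≤-trans le (ℕP.m∸n≤m r 1)))

  one-not-excluded : ∀ a b → ¬ (Excluded r a × Excluded r b) → ¬ Excluded r a ⊎ ¬ Excluded r b
  one-not-excluded a b ¬both with excluded? a
  ... | no ¬a = inj₁ ¬a
  ... | yes a = inj₂ (λ b → ¬both (a , b))

  not-both-excluded : ∀ D → D ≡ 1 ⊎ r ≤ D → D ≤ 2 ℕ.* r ℕ.+ 1 →
                      ∀ x → ¬ (Excluded r x × Excluded r (x + + D))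
  not-both-excluded D D-ok D≤ x ((t , t-ok , M∣x) , (s , s-ok , M∣x+D)) = clash D-ok
    where
    same : D ℕ.+ (2 ℕ.* t ℕ.+ 1) ≡ 2 ℕ.* s ℕ.+ 1
    same = congruent-in-range {Mod r} (x + + D)
      (ℕP.≤-trans (odd-positive t) (ℕP.m≤n+m _ D)) (bad-room r t D t-ok D≤)
      (odd-positive s) (bad-room r s 0 s-ok z≤n)
      (shift-congruence {+ Mod r} x (2 ℕ.* t ℕ.+ 1) D M∣x) M∣x+D
    clash : D ≡ 1 ⊎ r ≤ D → ⊥
    clash (inj₁ refl) = ℕP.even≢odd (suc t) s (trans (regroup t) (trans same (ℕP.+-comm _ 1)))
      where
      regroup : ∀ t → 2 ℕ.* suc t ≡ 1 ℕ.+ (2 ℕ.* t ℕ.+ 1)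
      regroup = solve-∀
    clash (inj₂ r≤D) = ℕP.<-irrefl (sym same) (begin-strict
        2 ℕ.* s ℕ.+ 1          ≤⟨ s-ok ⟩
        r ∸ 1                  ≤⟨ ℕP.m∸n≤m r 1 ⟩
        r                      ≤⟨ r≤D ⟩
        D                      <⟨ ℕP.m<m+n D (odd-positive t) ⟩
        D ℕ.+ (2 ℕ.* t ℕ.+ 1)  ∎)
      where open ≤-Reasoning

  row-pair : ∀ a b {D} → ∣ b - a ∣ ≡ D → D ≡ 1 ⊎ r ≤ D → D ≤ 2 ℕ.* r ℕ.+ 1 →
             ¬ Excluded r a ⊎ ¬ Excluded r b
  row-pair a b refl D-ok D≤ with row-split a b
  ... | inj₁ b≡ = one-not-excluded a b λ (ea , eb) →
          not-both-excluded _ D-ok D≤ a (ea , subst (Excluded r) b≡ eb)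
  ... | inj₂ a≡ = one-not-excluded a b λ (ea , eb) →
          not-both-excluded _ D-ok D≤ b (eb , subst (Excluded r) a≡ ea)

  -- Some x + 2k with k ≤ ⌊r/2⌋ is not excluded: if x has residue 2t+1,
  -- then x + 2(⌊r/2⌋ - t) has residue 2⌊r/2⌋ + 1, which is too large.
  not-excluded-nearby : 1 ≤ r → ∀ x → ∃[ k ] (k ≤ r / 2 × ¬ Excluded r (x + + (2 ℕ.* k)))
  not-excluded-nearby 1≤r x with excluded? x
  ... | no ¬x = 0 , z≤n , subst (¬_ ∘ Excluded r) (sym (ℤP.+-identityʳ x)) ¬x
  ... | yes (t , t-ok , M∣x) = k , ℕP.m∸n≤m h t , clash
    where
    h = r / 2
    k = h ∸ t
    reach : 2 ℕ.* k ℕ.+ (2 ℕ.* t ℕ.+ 1) ≡ 2 ℕ.* h ℕ.+ 1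
    reach = trans (regroup k t) (cong (λ m → 2 ℕ.* m ℕ.+ 1) (ℕP.m∸n+n≡m (ℕP.<⇒≤ (bad-index r t t-ok))))
      where
      regroup : ∀ k t → 2 ℕ.* k ℕ.+ (2 ℕ.* t ℕ.+ 1) ≡ 2 ℕ.* (k ℕ.+ t) ℕ.+ 1
      regroup = solve-∀
    2h+1≤M : 2 ℕ.* h ℕ.+ 1 ≤ Mod r
    2h+1≤M = subst (2 ℕ.* h ℕ.+ 1 ≤_) (sym (Mod≡ r))
               (ℕP.+-monoʳ-≤ (2 ℕ.* h) (ℕP.≤-trans 1≤r (ℕP.m≤m+n r (r ℕ.+ 0))))
    clash : ¬ Excluded r (x + + (2 ℕ.* k))
    clash (s , s-ok , M∣y) = ℕP.<-irrefl (sym h≡s) (bad-index r s s-ok)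
      where
      2h+1≡2s+1 : 2 ℕ.* h ℕ.+ 1 ≡ 2 ℕ.* s ℕ.+ 1
      2h+1≡2s+1 = congruent-in-range {Mod r} (x + + (2 ℕ.* k))
        (odd-positive h) 2h+1≤M (odd-positive s) (bad-room r s 0 s-ok z≤n)
        (subst (λ c → + Mod r ∣ ((x + + (2 ℕ.* k)) - + c)) reach
           (shift-congruence {+ Mod r} x (2 ℕ.* t ℕ.+ 1) (2 ℕ.* k) M∣x))
        M∣y
      h≡s : h ≡ s
      h≡s = ℕP.*-cancelˡ-≡ h s 2 (ℕP.+-cancelʳ-≡ 1 (2 ℕ.* h) (2 ℕ.* s) 2h+1≡2s+1)

claim9 : (r : ℕ) → 1 ℕ.≤ r → (n : ℤ) → (a b : ℤ) →
    (Adj (a , n * + (suc r)) (b , n * + (suc r)) → InC' r (a , n * + (suc r)) ⊎ InC' r (b , n * + (suc r)))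
    × ((∃[ k ] (Dist (a , n * + (suc r)) (b , n * + (suc r)) k × r ℕ.≤ k × k ℕ.≤ 2 ℕ.* r ℕ.+ 1)) → InC' r (a , n * + (suc r)) ⊎ InC' r (b , n * + (suc r)))
    × ((x : ℤ) → ∃[ k ] (k ℕ.≤ ⌈ r ℕ.+ 1 /2⌉ × InC' r (x + + (2 ℕ.* k) , n * + (suc r))))
claim9 r 1≤r n a b =
    (λ adj → on-row (row-pair a b (adj-row adj) (inj₁ refl) (ℕP.m≤n+m 1 (2 ℕ.* r))))
  , (λ (k , dist , r≤k , k≤2r+1) → on-row (row-pair a b (dist-row dist) (inj₂ r≤k) k≤2r+1))
  , λ x → let (k , k≤h , ¬y) = not-excluded-nearby 1≤r x
          in k , ℕP.≤-trans k≤h (half≤⌈r+1/2⌉ r) , in-C' (x + + (2 ℕ.* k)) ¬y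
  where
  open Exclusion r
  in-C' : ∀ x → ¬ Excluded r x → InC' r (x , n * + suc r)
  in-C' _ ¬x = n , refl , ¬x
  on-row : ¬ Excluded r a ⊎ ¬ Excluded r b → InC' r (a , n * + suc r) ⊎ InC' r (b , n * + suc r)
  on-row = Sum.map (in-C' a) (in-C' b)
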